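{- Let $C$ be a cubical complex and $n \geq 0$. Then $C$ embeds (as a cubical complex) into the cube $I^n$ if and only if the graph $G(C)$ (the $1$-skeleton of $C$) embeds as a graph into the graph $G(I^n)$ of the $n$-cube, i.e.\ there is an injection $V(C) \to \{0,1\}^n$ sending edges of $C$ to edges of $I^n$.
   Context: A cubical complex is a finite vertex set $V$ together with a collection $C$ of subsets of $V$ (faces) such that: $\emptyset \notin C$; $\{v\} \in C$ for every $v \in V$; for each $F \in C$, the poset $\{G \in C : G \subseteq F\}$ ordered by inclusion is isomorphic to the poset of non-empty faces of a cube; and for $F, G \in C$, $F \cap G$ is empty or in $C$. The cube $I^n$ is the cubical complex with vertex set $\{0,1\}^n$ whose faces are the sets of vertices of the non-empty faces of the geometric cube $[0,1]^n$ (equivalently, faces are indexed by $\{0,1,*\}^n$). A map of cubical complexes is a function between vertex sets sending faces to faces; an embedding is an injective map (identifying $C$ with a subcomplex). The graph $G(C)$ is the $1$-skeleton: vertices and $1$-dimensional faces (edges). -}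

module Defs where

open import Data.Nat using (ℕ; zero; suc)
open import Data.Bool using (Bool; true; false)
open import Data.Fin using (Fin)
open import Data.Vec using (Vec; []; _∷_)
open import Data.Fin.Subset using (Subset; _∈_; _⊆_; _∩_; _∪_; ⁅_⁆; Empty)
open import Data.Product using (Σ; ∃; _×_; _,_)
open import Data.Sum using (_⊎_)
open import Data.Unit using (⊤)
open import Data.Empty using (⊥)
open import Relation.Nullary using (¬_)
open import Relation.Binary.PropositionalEquality using (_≡_; _≢_)
open import Function.Bundles using (_⇔_)
open import Function.Definitions using (Injective)

-- The cube I^d.  Vertices: Vec Bool d (= {0,1}^d).
-- Non-empty faces of [0,1]^d are indexed by {0,1,*}^d.

data Tri : Set where
  o i ✶ : Tri

CubeFace : ℕ → Set
CubeFace d = Vec Tri d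

Matches : ∀ {d} → Vec Bool d → CubeFace d → Set
Matches []          []       = ⊤
Matches (false ∷ x) (o ∷ c)  = Matches x c
Matches (true  ∷ x) (i ∷ c)  = Matches x c
Matches (_     ∷ x) (✶ ∷ c)  = Matches x c
Matches (false ∷ x) (i ∷ c)  = ⊥
Matches (true  ∷ x) (o ∷ c)  = ⊥

_≤F_ : ∀ {d} → CubeFace d → CubeFace d → Set
c ≤F c' = ∀ x → Matches x c → Matches x c'

-- Cubical complexes on vertex set V = Fin m; a collection of faces is a
-- predicate on subsets of V.

-- The poset {G ∈ C : G ⊆ F} (ordered by inclusion) is isomorphic to the
-- poset of non-empty faces of I^d: ψ is a surjective order embedding
-- from the faces of I^d onto {G ∈ C : G ⊆ F}.
FacePosetIsCube : ∀ {m} → (Subset m → Set) → Subset m → ℕ → Set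
FacePosetIsCube {m} C F d =
  Σ (CubeFace d → Subset m) λ ψ →
      (∀ c → C (ψ c) × ψ c ⊆ F)
    × (∀ G → C G → G ⊆ F → ∃ λ c → ψ c ≡ G)
    × (∀ c c' → (ψ c ⊆ ψ c' → c ≤F c') × (c ≤F c' → ψ c ⊆ ψ c'))

record IsCubicalComplex {m : ℕ} (C : Subset m → Set) : Set₁ where
  field
    empty∉     : ∀ F → Empty F → ¬ C F
    singleton∈ : ∀ (v : Fin m) → C ⁅ v ⁆
    cubeLike   : ∀ F → C F → ∃ λ d → FacePosetIsCube C F d
    inter      : ∀ F G → C F → C G → Empty (F ∩ G) ⊎ C (F ∩ G)

ImageIsFace : ∀ {m n} → (Fin m → Vec Bool n) → Subset m → CubeFace n → Set
ImageIsFace {m} f F c =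
  ∀ x → (Matches x c → ∃ λ (v : Fin m) → v ∈ F × f v ≡ x)
      × ((∃ λ (v : Fin m) → v ∈ F × f v ≡ x) → Matches x c)

EmbedsInCube : ∀ {m} → (Subset m → Set) → ℕ → Set
EmbedsInCube {m} C n =
  Σ (Fin m → Vec Bool n) λ f →
    Injective _≡_ _≡_ f × (∀ F → C F → ∃ λ c → ImageIsFace f F c)

EdgeC : ∀ {m} → (Subset m → Set) → Fin m → Fin m → Set
EdgeC C u v = u ≢ v × C (⁅ u ⁆ ∪ ⁅ v ⁆)

EdgeCube : ∀ {n} → Vec Bool n → Vec Bool n → Set
EdgeCube {n} x y =
  x ≢ y × ∃ λ (c : CubeFace n) → ∀ z → (Matches z c → z ≡ x ⊎ z ≡ y)
                                       × (z ≡ x ⊎ z ≡ y → Matches z c)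

GraphEmbedsInCube : ∀ {m} → (Subset m → Set) → ℕ → Set
GraphEmbedsInCube {m} C n =
  Σ (Fin m → Vec Bool n) λ g →
    Injective _≡_ _≡_ g × (∀ u v → EdgeC C u v → EdgeCube (g u) (g v))

module Submission where

-- (⇒) is immediate: a face map sends the 1-dimensional face {u, v} to a
-- face of I^n with vertex set {f u, f v}, i.e. to an edge.
--
-- (⇐) rests on two facts.  First (rigidity of cube graphs), every injective
-- graph map h : Q_d → Q_n is the inclusion of a subcube: h carries the
-- flip in direction p at the origin to a flip in some direction π p, the
-- "square lemma" (two length-2 paths with different first directions bound
-- a square) propagates this to h (flip p x) = flip (π p) (h x) for every x,
-- and then the image of h is the face of I^n through h(0) that is free
-- exactly in the coordinates π(Fin d).  Second, a face F of C, whose face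
-- poset is that of I^d, has its vertices parametrised by {0,1}^d via a
-- bijection φ sending edges of I^d to edges of C.  Applying rigidity to
-- g ∘ φ shows that the graph embedding g maps every face onto a face.

open import Defs
open import Data.Nat using (ℕ)
open import Data.Fin.Subset using (Subset)
open import Function.Bundles using (_⇔_)

open import Data.Bool using (Bool; true; false; not)
open import Data.Bool.Properties using (not-involutive; not-¬; ¬-not) renaming (_≟_ to _≟ᵇ_)
open import Data.Fin using (Fin; zero; suc; _≟_)
open import Data.Fin.Properties using (any?; ¬∀⟶∃¬)
open import Data.Fin.Subset using (_∈_; _⊆_; _∪_; ⁅_⁆)
open import Data.Fin.Subset.Properties using (nonempty?; x∈⁅x⁆; x∈⁅y⁆⇒x≡y; x∈p∪q⁻; x∈p∪q⁺; ⊆-antisym)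
open import Data.Vec using (Vec; []; _∷_; lookup; tabulate; replicate; updateAt)
open import Data.Vec.Properties
  using (lookup∘updateAt; lookup∘updateAt′; updateAt-updateAt; updateAt-id-local; updateAt-commutes;
         lookup∘tabulate; tabulate∘lookup; tabulate-cong)
open import Data.Product using (∃; _×_; _,_; proj₁; proj₂)
open import Data.Sum using (_⊎_; inj₁; inj₂; [_,_]′)
import Data.Sum as Sum
open import Data.Unit using (⊤; tt)
open import Data.Empty using (⊥; ⊥-elim)
open import Relation.Nullary using (Dec; yes; no; contradiction)
open import Relation.Unary using (Decidable)
open import Relation.Binary.PropositionalEquality using (_≡_; _≢_; refl; sym; trans; cong; subst; module ≡-Reasoning)
open import Function using (_∘_; id)
open import Function.Definitions using (Injective)
open import Function.Bundles using (mk⇔)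

lookup-ext : ∀ {A : Set} {n} {x y : Vec A n} → (∀ k → lookup x k ≡ lookup y k) → x ≡ y
lookup-ext {x = x} {y} same =
  trans (sym (tabulate∘lookup x)) (trans (tabulate-cong same) (tabulate∘lookup y))

not-fixed : ∀ b → not b ≢ b
not-fixed b e = not-¬ refl (sym e)

-- Flipping coordinate j; the edges of Q_n are exactly the pairs {x, flip j x}.
flip : ∀ {n} → Fin n → Vec Bool n → Vec Bool n
flip j x = updateAt x j not

lookup-flip : ∀ {n} (j : Fin n) x → lookup (flip j x) j ≡ not (lookup x j)
lookup-flip j x = lookup∘updateAt j x

lookup-flip′ : ∀ {n} (j k : Fin n) x → k ≢ j → lookup (flip j x) k ≡ lookup x k
lookup-flip′ j k x k≢j = lookup∘updateAt′ k j k≢j x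

flip-involutive : ∀ {n} (j : Fin n) x → flip j (flip j x) ≡ x
flip-involutive j x =
  trans (updateAt-updateAt j x) (updateAt-id-local j x (not-involutive (lookup x j)))

flip-moves : ∀ {n} (j : Fin n) x → flip j x ≢ x
flip-moves j x e = not-fixed (lookup x j) (trans (sym (lookup-flip j x)) (cong (λ y → lookup y j) e))

flip-direction : ∀ {n} (p q : Fin n) a → flip p a ≡ flip q a → p ≡ q
flip-direction p q a e with p ≟ q
... | yes p≡q = p≡q
... | no p≢q = contradiction
  (trans (sym (lookup-flip p a)) (trans (cong (λ y → lookup y p) e) (lookup-flip′ q p a p≢q)))
  (not-fixed (lookup a p))

SameOutside : ∀ {n} → (Fin n → Set) → Vec Bool n → Vec Bool n → Set
SameOutside Free x a = ∀ k → Free k ⊎ lookup x k ≡ lookup a k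

sameOutside-flip : ∀ {n} {Free : Fin n → Set} (x a : Vec Bool n) {j} →
                   SameOutside Free x a → Free j → SameOutside Free (flip j x) a
sameOutside-flip x a {j} same free k with k ≟ j | same k
... | yes refl | _       = inj₁ free
... | no _     | inj₁ fk = inj₁ fk
... | no k≢j   | inj₂ e  = inj₂ (trans (lookup-flip′ j k x k≢j) e)

face-induction : ∀ {n} {Free : Fin n → Set} (P : Vec Bool n → Set) →
                 (∀ x j → Free j → P x → P (flip j x)) →
                 ∀ {a} → P a → ∀ x → SameOutside Free x a → P x
face-induction P step {[]} Pa [] _ = Pa
face-induction {Free = Free} P step {a₀ ∷ a} Pa (b ∷ x) same =
  face-induction {Free = Free ∘ suc} (λ y → P (b ∷ y)) (λ y j → step (b ∷ y) (suc j))
                 head-fixed x (same ∘ suc)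
  where
  head-fixed : P (b ∷ a)
  head-fixed with same zero | b ≟ᵇ a₀
  ... | inj₂ refl | _        = Pa
  ... | inj₁ _    | yes refl = Pa
  ... | inj₁ free | no b≢a₀  = subst (λ c → P (c ∷ a)) (sym (¬-not b≢a₀)) (step (a₀ ∷ a) zero free Pa)

flip-induction : ∀ {n} (P : Vec Bool n → Set) → (∀ x j → P x → P (flip j x)) →
                 ∀ {a} → P a → ∀ x → P x
flip-induction P step Pa x =
  face-induction {Free = λ _ → ⊤} P (λ y j _ → step y j) Pa x (λ _ → inj₁ tt)

square : ∀ {n} {a c : Vec Bool n} {p q r s : Fin n} → p ≢ q → c ≢ a →
         c ≡ flip r (flip p a) → c ≡ flip s (flip q a) → c ≡ flip p (flip q a)
square {a = a} {c} {p} {q} {r} {s} p≢q c≢a c≡rpa c≡sqa with r ≟ p | s ≟ p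
... | yes refl | _        = contradiction (trans c≡rpa (flip-involutive r a)) c≢a
... | no _     | yes refl = c≡sqa
... | no r≢p   | no s≢p   = contradiction (trans (sym p-flipped) p-kept) (not-fixed (lookup a p))
  where
  open ≡-Reasoning
  p-flipped : lookup c p ≡ not (lookup a p)
  p-flipped = begin
    lookup c p                   ≡⟨ cong (λ y → lookup y p) c≡rpa ⟩
    lookup (flip r (flip p a)) p ≡⟨ lookup-flip′ r p (flip p a) (r≢p ∘ sym) ⟩
    lookup (flip p a) p          ≡⟨ lookup-flip p a ⟩
    not (lookup a p)             ∎
  p-kept : lookup c p ≡ lookup a p
  p-kept = begin
    lookup c p                   ≡⟨ cong (λ y → lookup y p) c≡sqa ⟩
    lookup (flip s (flip q a)) p ≡⟨ lookup-flip′ s p (flip q a) (s≢p ∘ sym) ⟩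
    lookup (flip q a) p          ≡⟨ lookup-flip′ q p a p≢q ⟩
    lookup a p                   ∎

MatchesAt : Bool → Tri → Set
MatchesAt false o = ⊤
MatchesAt true  i = ⊤
MatchesAt _     ✶ = ⊤
MatchesAt false i = ⊥
MatchesAt true  o = ⊥

matches-∷⁻ : ∀ {n} b t {x : Vec Bool n} {c} → Matches (b ∷ x) (t ∷ c) → MatchesAt b t × Matches x c
matches-∷⁻ false o m = tt , m
matches-∷⁻ true  i m = tt , m
matches-∷⁻ false ✶ m = tt , m
matches-∷⁻ true  ✶ m = tt , m
matches-∷⁻ false i ()
matches-∷⁻ true  o ()

matches-∷⁺ : ∀ {n} b t {x : Vec Bool n} {c} → MatchesAt b t → Matches x c → Matches (b ∷ x) (t ∷ c)
matches-∷⁺ false o _ m = m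
matches-∷⁺ true  i _ m = m
matches-∷⁺ false ✶ _ m = m
matches-∷⁺ true  ✶ _ m = m
matches-∷⁺ false i () _
matches-∷⁺ true  o () _

matches⇒pointwise : ∀ {n} (x : Vec Bool n) c → Matches x c → ∀ k → MatchesAt (lookup x k) (lookup c k)
matches⇒pointwise (b ∷ _) (t ∷ _) m zero    = proj₁ (matches-∷⁻ b t m)
matches⇒pointwise (b ∷ x) (t ∷ c) m (suc k) = matches⇒pointwise x c (proj₂ (matches-∷⁻ b t m)) k

pointwise⇒matches : ∀ {n} (x : Vec Bool n) c → (∀ k → MatchesAt (lookup x k) (lookup c k)) → Matches x c
pointwise⇒matches []      []      _  = tt
pointwise⇒matches (b ∷ x) (t ∷ c) pw = matches-∷⁺ b t (pw zero) (pointwise⇒matches x c (pw ∘ suc))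

fixed : Bool → Tri
fixed false = o
fixed true  = i

matchesAt-fixed : ∀ b → MatchesAt b (fixed b)
matchesAt-fixed false = tt
matchesAt-fixed true  = tt

matchesAt-fixed⁻ : ∀ {a} b → MatchesAt a (fixed b) → a ≡ b
matchesAt-fixed⁻ {false} false _ = refl
matchesAt-fixed⁻ {true}  true  _ = refl
matchesAt-fixed⁻ {false} true  ()
matchesAt-fixed⁻ {true}  false ()

matchesAt-✶ : ∀ b → MatchesAt b ✶
matchesAt-✶ false = tt
matchesAt-✶ true  = tt

matchesAt-≢ : ∀ {a b} t → MatchesAt a t → MatchesAt b t → a ≢ b → t ≡ ✶
matchesAt-≢           ✶ _  _  _   = refl
matchesAt-≢ {false} {false} t _ _ a≢b = contradiction refl a≢b
matchesAt-≢ {true}  {true}  t _ _ a≢b = contradiction refl a≢b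
matchesAt-≢ {false} {true}  o _  () _
matchesAt-≢ {false} {true}  i () _  _
matchesAt-≢ {true}  {false} o () _  _
matchesAt-≢ {true}  {false} i _  () _

coordinate : ∀ {A : Set} → Bool → Dec A → Tri
coordinate b (yes _) = ✶
coordinate b (no _)  = fixed b

coordinate-matches⁻ : ∀ {A : Set} {z a} (dec : Dec A) → MatchesAt z (coordinate a dec) → A ⊎ z ≡ a
coordinate-matches⁻     (yes x) _ = inj₁ x
coordinate-matches⁻ {a = a} (no _)  m = inj₂ (matchesAt-fixed⁻ a m)

coordinate-matches⁺ : ∀ {A : Set} {z a} (dec : Dec A) → A ⊎ z ≡ a → MatchesAt z (coordinate a dec)
coordinate-matches⁺ {z = z} (yes _) _  = matchesAt-✶ z
coordinate-matches⁺ (no ¬x) (inj₁ x)    = contradiction x ¬x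
coordinate-matches⁺ {a = a} (no _) (inj₂ refl) = matchesAt-fixed a

subface : ∀ {n} {Free : Fin n → Set} → Vec Bool n → Decidable Free → CubeFace n
subface a free? = tabulate (λ k → coordinate (lookup a k) (free? k))

matches-subface⁻ : ∀ {n} {Free : Fin n → Set} (a z : Vec Bool n) (free? : Decidable Free) →
                   Matches z (subface a free?) → SameOutside Free z a
matches-subface⁻ a z free? m k =
  coordinate-matches⁻ (free? k)
    (subst (MatchesAt _) (lookup∘tabulate (λ k → coordinate (lookup a k) (free? k)) k) (matches⇒pointwise z _ m k))

matches-subface⁺ : ∀ {n} {Free : Fin n → Set} (a z : Vec Bool n) (free? : Decidable Free) →
                   SameOutside Free z a → Matches z (subface a free?)
matches-subface⁺ a z free? same = pointwise⇒matches z _ λ k →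
  subst (MatchesAt (lookup z k)) (sym (lookup∘tabulate (λ k → coordinate (lookup a k) (free? k)) k))
        (coordinate-matches⁺ (free? k) (same k))

nothing-free : ∀ {n} → Decidable {A = Fin n} (λ _ → ⊥)
nothing-free _ = no λ ()

vertexFace : ∀ {n} → Vec Bool n → CubeFace n
vertexFace x = subface x nothing-free

matches-vertexFace : ∀ {n} (x : Vec Bool n) → Matches x (vertexFace x)
matches-vertexFace x = matches-subface⁺ x x nothing-free (λ _ → inj₂ refl)

matches-vertexFace⁻ : ∀ {n} (x z : Vec Bool n) → Matches z (vertexFace x) → z ≡ x
matches-vertexFace⁻ x z m = lookup-ext (λ k → [ ⊥-elim , id ]′ (matches-subface⁻ x z nothing-free m k))

edgeFace : ∀ {n} → Vec Bool n → Fin n → CubeFace n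
edgeFace x j = subface x (_≟ j)

sameOutside-single : ∀ {n} {x z : Vec Bool n} {j} → SameOutside (_≡ j) z x → z ≡ x ⊎ z ≡ flip j x
sameOutside-single {x = x} {z} {j} same with lookup z j ≟ᵇ lookup x j
... | yes zj≡xj = inj₁ (lookup-ext agree)
  where
  agree : ∀ k → lookup z k ≡ lookup x k
  agree k with same k
  ... | inj₁ refl = zj≡xj
  ... | inj₂ e    = e
... | no zj≢xj = inj₂ (lookup-ext agree)
  where
  agree : ∀ k → lookup z k ≡ lookup (flip j x) k
  agree k with k ≟ j | same k
  ... | yes refl | _       = trans (¬-not zj≢xj) (sym (lookup-flip j x))
  ... | no k≢j   | inj₁ e  = contradiction e k≢j
  ... | no k≢j   | inj₂ e  = trans e (sym (lookup-flip′ j k x k≢j))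

matches-edgeFace⁻ : ∀ {n} (x : Vec Bool n) j z → Matches z (edgeFace x j) → z ≡ x ⊎ z ≡ flip j x
matches-edgeFace⁻ x j z m = sameOutside-single (matches-subface⁻ x z (_≟ j) m)

matches-edgeFace⁺ : ∀ {n} (x : Vec Bool n) j z → z ≡ x ⊎ z ≡ flip j x → Matches z (edgeFace x j)
matches-edgeFace⁺ x j .x (inj₁ refl) = matches-subface⁺ x x (_≟ j) (λ _ → inj₂ refl)
matches-edgeFace⁺ x j .(flip j x) (inj₂ refl) = matches-subface⁺ x (flip j x) (_≟ j) off-j
  where
  off-j : SameOutside (_≡ j) (flip j x) x
  off-j k with k ≟ j
  ... | yes k≡j = inj₁ k≡j
  ... | no k≢j  = inj₂ (lookup-flip′ j k x k≢j)

someVertex : ∀ {n} (c : CubeFace n) → ∃ λ x → Matches x c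
someVertex []      = [] , tt
someVertex (o ∷ c) = false ∷ proj₁ (someVertex c) , proj₂ (someVertex c)
someVertex (i ∷ c) = true  ∷ proj₁ (someVertex c) , proj₂ (someVertex c)
someVertex (✶ ∷ c) = false ∷ proj₁ (someVertex c) , proj₂ (someVertex c)

-- A face containing two vertices that differ in coordinate j is free in j,
-- so it contains the flip in direction j of each of its vertices.
matches-flip : ∀ {n} (x y : Vec Bool n) c j → Matches x c → Matches y c →
               lookup x j ≢ lookup y j → Matches (flip j x) c
matches-flip x y c j mx my xj≢yj = pointwise⇒matches (flip j x) c at
  where
  at : ∀ k → MatchesAt (lookup (flip j x) k) (lookup c k)
  at k with k ≟ j
  ... | yes refl = subst (MatchesAt _) (sym (matchesAt-≢ _ (matches⇒pointwise x c mx k) (matches⇒pointwise y c my k) xj≢yj))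
                         (matchesAt-✶ _)
  ... | no k≢j   = subst (λ b → MatchesAt b (lookup c k)) (sym (lookup-flip′ j k x k≢j)) (matches⇒pointwise x c mx k)

-- If {x, y} is an edge of I^n, then y = flip j x for a coordinate j where
-- they differ: flip j x lies in the edge and is not x.
edge⇒flip : ∀ {n} {x y : Vec Bool n} → EdgeCube x y → ∃ λ j → y ≡ flip j x
edge⇒flip {n} {x} {y} (x≢y , c , vertices) = j , sym flip≡y
  where
  differ : ∃ λ j → lookup x j ≢ lookup y j
  differ = ¬∀⟶∃¬ n _ (λ k → lookup x k ≟ᵇ lookup y k) (x≢y ∘ lookup-ext)
  j = proj₁ differ
  flip≡y : flip j x ≡ y
  flip≡y with proj₁ (vertices (flip j x))
                (matches-flip x y c j (proj₂ (vertices x) (inj₁ refl)) (proj₂ (vertices y) (inj₂ refl)) (proj₂ differ))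
  ... | inj₁ e = contradiction e (flip-moves j x)
  ... | inj₂ e = e

module Rigidity {d n : ℕ} (h : Vec Bool d → Vec Bool n) (h-inj : Injective _≡_ _≡_ h)
                (h-adj : ∀ x j → ∃ λ r → h (flip j x) ≡ flip r (h x)) where

  origin : Vec Bool d
  origin = replicate d false

  π : Fin d → Fin n
  π p = proj₁ (h-adj origin p)

  π-inj : ∀ {p q} → π p ≡ π q → p ≡ q
  π-inj {p} {q} πp≡πq = flip-direction p q origin (h-inj (begin
    h (flip p origin)        ≡⟨ proj₂ (h-adj origin p) ⟩
    flip (π p) (h origin)    ≡⟨ cong (λ r → flip r (h origin)) πp≡πq ⟩
    flip (π q) (h origin)    ≡⟨ proj₂ (h-adj origin q) ⟨
    h (flip q origin)        ∎))
    where open ≡-Reasoning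

  Transports : Vec Bool d → Set
  Transports x = ∀ p → h (flip p x) ≡ flip (π p) (h x)

  -- The key step: by the square lemma the property moves along edges.
  transports-flip : ∀ x j → Transports x → Transports (flip j x)
  transports-flip x j at-x p with p ≟ j
  ... | yes refl = begin
    h (flip p (flip p x))           ≡⟨ cong h (flip-involutive p x) ⟩
    h x                             ≡⟨ flip-involutive (π p) (h x) ⟨
    flip (π p) (flip (π p) (h x))   ≡⟨ cong (flip (π p)) (at-x p) ⟨
    flip (π p) (h (flip p x))       ∎
    where open ≡-Reasoning
  ... | no p≢j = trans (square πp≢πj c≢hx via-p via-j) (cong (flip (π p)) (sym (at-x j)))
    where
    open ≡-Reasoning
    c = h (flip p (flip j x))
    πp≢πj : π p ≢ π j
    πp≢πj = p≢j ∘ π-inj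
    c≢hx : c ≢ h x
    c≢hx e = p≢j (sym (flip-direction j p x (begin
      flip j x                      ≡⟨ flip-involutive p (flip j x) ⟨
      flip p (flip p (flip j x))    ≡⟨ cong (flip p) (h-inj e) ⟩
      flip p x                      ∎)))
    via-p : c ≡ flip (proj₁ (h-adj (flip p x) j)) (flip (π p) (h x))
    via-p = begin
      c                                                 ≡⟨ cong h (updateAt-commutes p j p≢j x) ⟩
      h (flip j (flip p x))                             ≡⟨ proj₂ (h-adj (flip p x) j) ⟩
      flip (proj₁ (h-adj (flip p x) j)) (h (flip p x))  ≡⟨ cong (flip _) (at-x p) ⟩
      flip (proj₁ (h-adj (flip p x) j)) (flip (π p) (h x)) ∎
    via-j : c ≡ flip (proj₁ (h-adj (flip j x) p)) (flip (π j) (h x))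
    via-j = trans (proj₂ (h-adj (flip j x) p)) (cong (flip _) (at-x j))

  transports-everywhere : ∀ x → Transports x
  transports-everywhere = flip-induction Transports transports-flip (λ p → proj₂ (h-adj origin p))

  InImage : Fin n → Set
  InImage k = ∃ λ p → π p ≡ k

  inImage? : Decidable InImage
  inImage? k = any? (λ p → π p ≟ k)

  imageFace : CubeFace n
  imageFace = subface (h origin) inImage?

  image⊆face : ∀ x → SameOutside InImage (h x) (h origin)
  image⊆face = flip-induction (λ x → SameOutside InImage (h x) (h origin)) step (λ _ → inj₂ refl)
    where
    step : ∀ x j → SameOutside InImage (h x) (h origin) → SameOutside InImage (h (flip j x)) (h origin)
    step x j same = subst (λ y → SameOutside InImage y (h origin)) (sym (transports-everywhere x j))
                          (sameOutside-flip (h x) (h origin) same (j , refl))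

  face⊆image : ∀ y → SameOutside InImage y (h origin) → ∃ λ x → h x ≡ y
  face⊆image = face-induction (λ y → ∃ λ x → h x ≡ y) step (origin , refl)
    where
    step : ∀ y k → InImage k → (∃ λ x → h x ≡ y) → ∃ λ x → h x ≡ flip k y
    step _ _ (p , refl) (x , refl) = flip p x , transports-everywhere x p

  image-is-face : ∀ y → (Matches y imageFace → ∃ λ x → h x ≡ y) × ((∃ λ x → h x ≡ y) → Matches y imageFace)
  image-is-face y =
      (λ m → face⊆image y (matches-subface⁻ (h origin) y inImage? m))
    , λ { (x , refl) → matches-subface⁺ (h origin) (h x) inImage? (image⊆face x) }

∈-pair⁻ : ∀ {m} {u v w : Fin m} → w ∈ ⁅ u ⁆ ∪ ⁅ v ⁆ → w ≡ u ⊎ w ≡ v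
∈-pair⁻ {u = u} {v} w∈ = Sum.map (x∈⁅y⁆⇒x≡y u) (x∈⁅y⁆⇒x≡y v) (x∈p∪q⁻ ⁅ u ⁆ ⁅ v ⁆ w∈)

∈-pair⁺ : ∀ {m} {u v w : Fin m} → w ≡ u ⊎ w ≡ v → w ∈ ⁅ u ⁆ ∪ ⁅ v ⁆
∈-pair⁺ (inj₁ refl) = x∈p∪q⁺ (inj₁ (x∈⁅x⁆ _))
∈-pair⁺ (inj₂ refl) = x∈p∪q⁺ (inj₂ (x∈⁅x⁆ _))

-- The vertex φ x of
-- F is an element of the face ψ (vertexFace x); φ is a bijection
-- {0,1}^d → F sending edges of I^d to edges of C.
module FaceVertices {m d : ℕ} {C : Subset m → Set} (cc : IsCubicalComplex C) {F : Subset m}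
                    (ψ : CubeFace d → Subset m)
                    (ψ-face  : ∀ c → C (ψ c) × ψ c ⊆ F)
                    (ψ-onto  : ∀ G → C G → G ⊆ F → ∃ λ c → ψ c ≡ G)
                    (ψ-order : ∀ c c' → (ψ c ⊆ ψ c' → c ≤F c') × (c ≤F c' → ψ c ⊆ ψ c')) where

  open IsCubicalComplex cc

  -- ψ (vertexFace x) is a face of C, hence nonempty; φ x is an element of it.
  φ-spec : ∀ x → ∃ λ u → u ∈ ψ (vertexFace x)
  φ-spec x with nonempty? (ψ (vertexFace x))
  ... | yes nonempty = nonempty
  ... | no empty     = ⊥-elim (empty∉ _ empty (proj₁ (ψ-face (vertexFace x))))

  φ : Vec Bool d → Fin m
  φ x = proj₁ (φ-spec x)

  φ∈F : ∀ x → φ x ∈ F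
  φ∈F x = proj₂ (ψ-face (vertexFace x)) (proj₂ (φ-spec x))

  -- ψ is monotone, so the vertices of a cube face c are sent into ψ c.
  φ∈ψ : ∀ x c → Matches x c → φ x ∈ ψ c
  φ∈ψ x c x∈c = proj₂ (ψ-order (vertexFace x) c) below (proj₂ (φ-spec x))
    where
    below : vertexFace x ≤F c
    below y y∈x = subst (λ z → Matches z c) (sym (matches-vertexFace⁻ x y y∈x)) x∈c

  -- Conversely every u ∈ F is φ z for a vertex z lying in every cube face c
  -- with u ∈ ψ c: take the cube face c₀ with ψ c₀ = {u} and z ∈ c₀.
  vertex-of : ∀ u → u ∈ F → ∃ λ z → φ z ≡ u × (∀ c → u ∈ ψ c → Matches z c)
  vertex-of u u∈F = z , φz≡u , z∈
    where
    singleton : ∃ λ c₀ → ψ c₀ ≡ ⁅ u ⁆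
    singleton = ψ-onto ⁅ u ⁆ (singleton∈ u) (λ {v} v∈ → subst (_∈ F) (sym (x∈⁅y⁆⇒x≡y u v∈)) u∈F)
    c₀ = proj₁ singleton
    z = proj₁ (someVertex c₀)
    z∈c₀ = proj₂ (someVertex c₀)
    φz≡u : φ z ≡ u
    φz≡u = x∈⁅y⁆⇒x≡y u (subst (φ z ∈_) (proj₂ singleton) (φ∈ψ z c₀ z∈c₀))
    z∈ : ∀ c → u ∈ ψ c → Matches z c
    z∈ c u∈c = proj₁ (ψ-order c₀ c) c₀⊆c z z∈c₀
      where
      c₀⊆c : ψ c₀ ⊆ ψ c
      c₀⊆c {v} v∈ = subst (_∈ ψ c) (sym (x∈⁅y⁆⇒x≡y u (subst (v ∈_) (proj₂ singleton) v∈))) u∈c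

  -- Both x and x' equal the vertex z provided by vertex-of (φ x).
  φ-inj : Injective _≡_ _≡_ φ
  φ-inj {x} {x'} φx≡φx' = trans (sym (matches-vertexFace⁻ x z (z∈ _ (proj₂ (φ-spec x)))))
                                (matches-vertexFace⁻ x' z (z∈ _ (subst (_∈ ψ (vertexFace x')) (sym φx≡φx') (proj₂ (φ-spec x')))))
    where
    z = proj₁ (vertex-of (φ x) (φ∈F x))
    z∈ = proj₂ (proj₂ (vertex-of (φ x) (φ∈F x)))

  φ-onto : ∀ {u} → u ∈ F → ∃ λ x → φ x ≡ u
  φ-onto {u} u∈F = proj₁ (vertex-of u u∈F) , proj₁ (proj₂ (vertex-of u u∈F))

  ψ-edge : ∀ x j → ψ (edgeFace x j) ≡ ⁅ φ x ⁆ ∪ ⁅ φ (flip j x) ⁆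
  ψ-edge x j = ⊆-antisym ψ⊆pair pair⊆ψ
    where
    ψ⊆pair : ψ (edgeFace x j) ⊆ ⁅ φ x ⁆ ∪ ⁅ φ (flip j x) ⁆
    ψ⊆pair {u} u∈ with vertex-of u (proj₂ (ψ-face _) u∈)
    ... | z , refl , z∈ = ∈-pair⁺ (Sum.map (cong φ) (cong φ) (matches-edgeFace⁻ x j z (z∈ _ u∈)))
    pair⊆ψ : ⁅ φ x ⁆ ∪ ⁅ φ (flip j x) ⁆ ⊆ ψ (edgeFace x j)
    pair⊆ψ {u} u∈ with ∈-pair⁻ u∈
    ... | inj₁ refl = φ∈ψ x _ (matches-edgeFace⁺ x j x (inj₁ refl))
    ... | inj₂ refl = φ∈ψ (flip j x) _ (matches-edgeFace⁺ x j (flip j x) (inj₂ refl))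

  φ-edge : ∀ x j → EdgeC C (φ x) (φ (flip j x))
  φ-edge x j = (λ e → flip-moves j x (sym (φ-inj e))) , subst C (ψ-edge x j) (proj₁ (ψ-face _))

embedding⇒graph-embedding : ∀ {m} {C : Subset m → Set} {n} → EmbedsInCube C n → GraphEmbedsInCube C n
embedding⇒graph-embedding {C = C} (f , f-inj , f-faces) = f , f-inj , edge
  where
  edge : ∀ u v → EdgeC C u v → EdgeCube (f u) (f v)
  edge u v (u≢v , C-uv) with f-faces _ C-uv
  ... | c , c-image = (u≢v ∘ f-inj) , c , λ z → on-edge z , edge-on z
    where
    on-edge : ∀ z → Matches z c → z ≡ f u ⊎ z ≡ f v
    on-edge z z∈c with proj₁ (c-image z) z∈c
    ... | w , w∈ , refl = Sum.map (cong f) (cong f) (∈-pair⁻ w∈)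
    edge-on : ∀ z → z ≡ f u ⊎ z ≡ f v → Matches z c
    edge-on z (inj₁ refl) = proj₂ (c-image z) (u , ∈-pair⁺ (inj₁ refl) , refl)
    edge-on z (inj₂ refl) = proj₂ (c-image z) (v , ∈-pair⁺ (inj₂ refl) , refl)

-- A graph embedding g maps every face F onto a face: parametrise F by
-- φ : {0,1}^d → F and apply rigidity to the cube-graph embedding g ∘ φ.
graph-embedding-maps-faces : ∀ {m} {C : Subset m → Set} → IsCubicalComplex C → ∀ {n} →
  (g : Fin m → Vec Bool n) → Injective _≡_ _≡_ g → (∀ u v → EdgeC C u v → EdgeCube (g u) (g v)) →
  ∀ F → C F → ∃ λ c → ImageIsFace g F c
graph-embedding-maps-faces cc g g-inj g-edge F CF with IsCubicalComplex.cubeLike cc F CF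
... | d , ψ , ψ-face , ψ-onto , ψ-order = imageFace , image
  where
  open FaceVertices cc ψ ψ-face ψ-onto ψ-order
  open Rigidity (g ∘ φ) (φ-inj ∘ g-inj) (λ x j → edge⇒flip (g-edge _ _ (φ-edge x j)))
  image : ImageIsFace g F imageFace
  image y = (λ y∈ → let (x , gφx≡y) = proj₁ (image-is-face y) y∈ in φ x , φ∈F x , gφx≡y)
          , λ { (v , v∈F , refl) → let (x , φx≡v) = φ-onto v∈F in proj₂ (image-is-face (g v)) (x , cong g φx≡v) }

corollary1p2 : ∀ (m : ℕ) (C : Subset m → Set) → IsCubicalComplex C →
    ∀ (n : ℕ) → EmbedsInCube C n ⇔ GraphEmbedsInCube C n
corollary1p2 m C cc n = mk⇔ embedding⇒graph-embedding
  λ (g , g-inj , g-edge) → g , g-inj , graph-embedding-maps-faces cc g g-inj g-edge
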